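{- Let $\theta\in\{\lambda,\mathsf{J}\}$ be a modal rewriting rule. For all modal trees $\mathtt{T},\mathtt{S}$: if $\mathtt{T}\hookrightarrow^{\theta}\circ\hookrightarrow^{\pi^+}\mathtt{S}$, then $\mathtt{T}\hookrightarrow^{\pi^+*}\circ\hookrightarrow^{\theta*}\circ\hookrightarrow^{\sigma*}\mathtt{S}$.
   Context: Modal trees: recursively, pairs $\langle\Delta;\Gamma\rangle$ with $\Delta$ a finite list of propositional variables and $\Gamma$ a finite list of pairs $(\alpha,\mathtt{S})$, $\alpha<\omega$, $\mathtt{S}$ a modal tree. Positions: $\mathrm{Pos}(\langle\Delta;\varnothing\rangle)=\{\epsilon\}$; $\mathrm{Pos}(\langle\Delta;[(\alpha_1,\mathtt{S}_1),\dots,(\alpha_n,\mathtt{S}_n)]\rangle)=\{\epsilon\}\cup\bigcup_{i=1}^n\{i\mathbf{k}\mid\mathbf{k}\in\mathrm{Pos}(\mathtt{S}_i)\}$. Subtree: $\mathtt{T}|_\epsilon=\mathtt{T}$, $\mathtt{T}|_{i\mathbf{r}}=\mathtt{S}_i|_{\mathbf{r}}$. Replacement: $\mathtt{T}[\mathtt{S}]_\epsilon=\mathtt{S}$, $\mathtt{T}[\mathtt{S}]_{i\mathbf{r}}$ is $\mathtt{T}$ with its $i$-th child $\mathtt{S}_i$ replaced by $\mathtt{S}_i[\mathtt{S}]_{\mathbf{r}}$ (same edge label). List operations, for $0<i,j\le|\Gamma|$: $\#_i\Gamma$ is the $i$-th element; $\Gamma^{ -i}$ deletes it; $\Gamma^{+i}=(\#_i\Gamma)\frown\Gamma$;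 $\Gamma[x]_i$ replaces the $i$-th element by $x$; $\Gamma^{i\leftrightarrow j}$ swaps the $i$-th and $j$-th elements. Rules (for a modal tree $\mathtt{T}$, $\mathbf{k}\in\mathrm{Pos}(\mathtt{T})$, $\mathtt{T}|_\mathbf{k}=\langle\Delta;\Gamma\rangle$): ($\sigma$) $\mathtt{T}\hookrightarrow^{\sigma}\mathtt{T}[\langle\Delta;\Gamma^{i\leftrightarrow j}\rangle]_\mathbf{k}$, $i\ne j$; ($\pi^+$) $\mathtt{T}\hookrightarrow^{\pi^+}\mathtt{T}[\langle\Delta;\Gamma^{+i}\rangle]_\mathbf{k}$; ($\lambda$) if $\#_i\Gamma=(\alpha,\mathtt{S})$ and $\alpha>\beta$, then $\mathtt{T}\hookrightarrow^{\lambda}\mathtt{T}[\langle\Delta;\Gamma[(\beta,\mathtt{S})]_i\rangle]_\mathbf{k}$; ($\mathsf{J}$) if $i\ne j$, $\#_i\Gamma=(\alpha,\langle\tilde\Delta;\tilde\Gamma\rangle)$, $\#_j\Gamma=(\beta,\mathtt{S})$, $\alpha>\beta$, then $\mathtt{T}\hookrightarrow^{\mathsf{J}}\mathtt{T}[\langle\Delta;(\Gamma[(\alpha,\langle\tilde\Delta;\tilde\Gamma\frown(\beta,\mathtt{S})\rangle)]_i)^{ -j}\rangle]_\mathbf{k}$. Notation: $\mathtt{T}\hookrightarrow^{\mu_1}\circ\hookrightarrow^{\mu_2}\mathtt{S}$ means there is $\mathtt{U}$ with $\mathtt{T}\hookrightarrow^{\mu_1}\mathtt{U}\hookrightarrow^{\mu_2}\mathtt{S}$;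 $\hookrightarrow^{\mu*}$ means zero or more applications of rule $\mu$. -}

module Defs where

open import Data.Nat using (ℕ; zero; suc; _<_)
open import Data.List using (List; []; _∷_; _++_; [_])
open import Data.Maybe using (Maybe; just; nothing)
open import Data.Product using (_×_; _,_; ∃; ∃-syntax)
open import Relation.Binary.PropositionalEquality using (_≡_; _≢_)
open import Relation.Binary.Construct.Closure.ReflexiveTransitive using (Star)

PropVar : Set
PropVar = ℕ

-- Modal trees ⟨Δ;Γ⟩ : Δ a list of variables, Γ a list of (α , S), α < ω.
data Tree : Set where
  ⟨_﹔_⟩ : List PropVar → List (ℕ × Tree) → Tree

-- 1-based list operations (index i is valid iff 0 < i ≤ |Γ|)

nth : {A : Set} → List A → ℕ → Maybe A
nth []       _             = nothing
nth (x ∷ xs) zero          = nothing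
nth (x ∷ xs) (suc zero)    = just x
nth (x ∷ xs) (suc (suc i)) = nth xs (suc i)

delete : {A : Set} → List A → ℕ → List A
delete []       _             = []
delete (x ∷ xs) zero          = x ∷ xs
delete (x ∷ xs) (suc zero)    = xs
delete (x ∷ xs) (suc (suc i)) = x ∷ delete xs (suc i)

set : {A : Set} → List A → ℕ → A → List A
set []       _             y = []
set (x ∷ xs) zero          y = x ∷ xs
set (x ∷ xs) (suc zero)    y = y ∷ xs
set (x ∷ xs) (suc (suc i)) y = x ∷ set xs (suc i) y

Pos : Set
Pos = List ℕ

mutual
  subtree : Tree → Pos → Maybe Tree
  subtree T [] = just T
  subtree ⟨ Δ ﹔ Γ ⟩ (i ∷ r) = subtreeChild Γ i r

  subtreeChild : List (ℕ × Tree) → ℕ → Pos → Maybe Tree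
  subtreeChild []             _             r = nothing
  subtreeChild ((α , S) ∷ Γ) zero          r = nothing
  subtreeChild ((α , S) ∷ Γ) (suc zero)    r = subtree S r
  subtreeChild ((α , S) ∷ Γ) (suc (suc i)) r = subtreeChild Γ (suc i) r

mutual
  replace : Tree → Pos → Tree → Tree
  replace T [] U = U
  replace ⟨ Δ ﹔ Γ ⟩ (i ∷ r) U = ⟨ Δ ﹔ replaceChild Γ i r U ⟩

  replaceChild : List (ℕ × Tree) → ℕ → Pos → Tree → List (ℕ × Tree)
  replaceChild []             _             r U = []
  replaceChild ((α , S) ∷ Γ) zero          r U = (α , S) ∷ Γ
  replaceChild ((α , S) ∷ Γ) (suc zero)    r U = (α , replace S r U) ∷ Γ
  replaceChild ((α , S) ∷ Γ) (suc (suc i)) r U = (α , S) ∷ replaceChild Γ (suc i) r U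

data Rule : Set where
  σ π⁺ λ' J : Rule

data LocalStep : Rule → List (ℕ × Tree) → List (ℕ × Tree) → Set where
  σ-step : ∀ {Γ i j x y} → i ≢ j → nth Γ i ≡ just x → nth Γ j ≡ just y →
           LocalStep σ Γ (set (set Γ i y) j x)
  π⁺-step : ∀ {Γ i x} → nth Γ i ≡ just x →
            LocalStep π⁺ Γ (x ∷ Γ)
  λ-step : ∀ {Γ i α β S} → nth Γ i ≡ just (α , S) → β < α →
           LocalStep λ' Γ (set Γ i (β , S))
  J-step : ∀ {Γ i j α β Δ̃ Γ̃ S} → i ≢ j →
           nth Γ i ≡ just (α , ⟨ Δ̃ ﹔ Γ̃ ⟩) → nth Γ j ≡ just (β , S) → β < α →
           LocalStep J Γ (delete (set Γ i (α , ⟨ Δ̃ ﹔ Γ̃ ++ [ (β , S) ] ⟩)) j)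

data Step (μ : Rule) : Tree → Tree → Set where
  step : ∀ {T Δ Γ Γ'} (k : Pos) → subtree T k ≡ just ⟨ Δ ﹔ Γ ⟩ →
         LocalStep μ Γ Γ' → Step μ T (replace T k ⟨ Δ ﹔ Γ' ⟩)

Steps : Rule → Tree → Tree → Set
Steps μ = Star (Step μ)

{-# OPTIONS --safe #-}
module Submission where

open import Defs
open import Data.Sum using (_⊎_; inj₁; inj₂)
open import Data.Product using (_×_; ∃; ∃-syntax; _,_)
open import Data.Nat using (ℕ; zero; suc; _<_)
open import Data.Nat.Properties using (_≟_; suc-injective)
open import Data.List using (List; []; _∷_; _++_; [_])
open import Data.Maybe using (just)
open import Data.Empty using (⊥-elim)
open import Function using (_∘_)
open import Relation.Nullary using (yes; no)
open import Relation.Binary.PropositionalEquality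
  using (_≡_; _≢_; refl; sym; trans; cong; subst)
open import Relation.Binary.Construct.Closure.ReflexiveTransitive
  using (Star; ε; _◅_; _◅◅_; gmap; return)

-- A λ- or J-step changes one or two entries of a single node; the π⁺-step after it
-- duplicates an entry or acts inside one. If that entry was not touched by θ, the two
-- steps commute. If it was, duplicate the original entry first and apply θ to both
-- copies (for J, the donor entry has to be duplicated as well). The one exception is
-- a π⁺-step duplicating the entry that J has just appended to the receiving list:
-- doing J twice appends two copies at the end, and σ-swaps rotate one to the front.

module _ {A : Set} where

  nth-zero : ∀ (L : List A) {x} → nth L 0 ≢ just x
  nth-zero []      ()
  nth-zero (_ ∷ _) ()

  nth-just⇒≢0 : ∀ (L : List A) {i x} → nth L i ≡ just x → i ≢ 0
  nth-just⇒≢0 L p refl = nth-zero L p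

  nth-∷ : ∀ (L : List A) {i w x} → nth L i ≡ just x → nth (w ∷ L) (suc i) ≡ just x
  nth-∷ L {zero}  p = ⊥-elim (nth-zero L p)
  nth-∷ L {suc i} p = p

  set-∷ : ∀ (L : List A) {i w x y} → nth L i ≡ just x → set (w ∷ L) (suc i) y ≡ w ∷ set L i y
  set-∷ L {zero}  p = ⊥-elim (nth-zero L p)
  set-∷ L {suc i} p = refl

  set-zero : ∀ (L : List A) y → set L 0 y ≡ L
  set-zero []      y = refl
  set-zero (_ ∷ _) y = refl

  delete-zero : ∀ (L : List A) → delete L 0 ≡ L
  delete-zero []      = refl
  delete-zero (_ ∷ _) = refl

  set-nth-id : ∀ (L : List A) i {x} → nth L i ≡ just x → set L i x ≡ L
  set-nth-id []      i             ()
  set-nth-id (y ∷ L) zero          ()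
  set-nth-id (y ∷ L) (suc zero)    refl = refl
  set-nth-id (y ∷ L) (suc (suc i)) p    = cong (y ∷_) (set-nth-id L (suc i) p)

  nth-set-≡ : ∀ (L : List A) i {x y} → nth L i ≡ just x → nth (set L i y) i ≡ just y
  nth-set-≡ []      i             ()
  nth-set-≡ (w ∷ L) zero          ()
  nth-set-≡ (w ∷ L) (suc zero)    p = refl
  nth-set-≡ (w ∷ L) (suc (suc i)) p = nth-set-≡ L (suc i) p

  nth-set-≢ : ∀ (L : List A) {i c} y → i ≢ c → nth (set L i y) c ≡ nth L c
  nth-set-≢ []      {i}           {c}           y i≢c = refl
  nth-set-≢ (x ∷ L) {zero}        {c}           y i≢c = refl
  nth-set-≢ (x ∷ L) {suc zero}    {zero}        y i≢c = refl
  nth-set-≢ (x ∷ L) {suc zero}    {suc zero}    y i≢c = ⊥-elim (i≢c refl)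
  nth-set-≢ (x ∷ L) {suc zero}    {suc (suc c)} y i≢c = refl
  nth-set-≢ (x ∷ L) {suc (suc i)} {zero}        y i≢c = refl
  nth-set-≢ (x ∷ L) {suc (suc i)} {suc zero}    y i≢c = refl
  nth-set-≢ (x ∷ L) {suc (suc i)} {suc (suc c)} y i≢c =
    nth-set-≢ L y (i≢c ∘ cong suc)

  set-set-≡ : ∀ (L : List A) i y z → set (set L i y) i z ≡ set L i z
  set-set-≡ []      i             y z = refl
  set-set-≡ (x ∷ L) zero          y z = refl
  set-set-≡ (x ∷ L) (suc zero)    y z = refl
  set-set-≡ (x ∷ L) (suc (suc i)) y z = cong (x ∷_) (set-set-≡ L (suc i) y z)

  set-set-≢ : ∀ (L : List A) {i c y z} → i ≢ c → set (set L i y) c z ≡ set (set L c z) i y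
  set-set-≢ []      {i}           {c}           i≢c = refl
  set-set-≢ (x ∷ L) {zero}        {c}           i≢c = sym (set-zero _ _)
  set-set-≢ (x ∷ L) {suc i}       {zero}        i≢c = set-zero _ _
  set-set-≢ (x ∷ L) {suc zero}    {suc zero}    i≢c = ⊥-elim (i≢c refl)
  set-set-≢ (x ∷ L) {suc zero}    {suc (suc c)} i≢c = refl
  set-set-≢ (x ∷ L) {suc (suc i)} {suc zero}    i≢c = refl
  set-set-≢ (x ∷ L) {suc (suc i)} {suc (suc c)} i≢c =
    cong (x ∷_) (set-set-≢ L (i≢c ∘ cong suc))

  delete-set-≡ : ∀ (L : List A) j y → delete (set L j y) j ≡ delete L j
  delete-set-≡ []      j             y = refl
  delete-set-≡ (x ∷ L) zero          y = refl
  delete-set-≡ (x ∷ L) (suc zero)    y = refl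
  delete-set-≡ (x ∷ L) (suc (suc j)) y = cong (x ∷_) (delete-set-≡ L (suc j) y)

  nth-set⁻ : ∀ (L : List A) i c y {x} → nth (set L i y) c ≡ just x →
             (c ≡ i × x ≡ y) ⊎ (c ≢ i × nth L c ≡ just x)
  nth-set⁻ L i c y p with c ≟ i
  ... | yes refl = inj₁ (refl , overwritten L i p)
    where
    overwritten : ∀ L i {x} → nth (set L i y) i ≡ just x → x ≡ y
    overwritten []      i             ()
    overwritten (w ∷ L) zero          ()
    overwritten (w ∷ L) (suc zero)    refl = refl
    overwritten (w ∷ L) (suc (suc i)) p    = overwritten L (suc i) p
  ... | no c≢i = inj₂ (c≢i , trans (sym (nth-set-≢ L y (c≢i ∘ sym))) p)

  nth-delete⁻ : ∀ (L : List A) j c {x} → nth (delete L j) c ≡ just x →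
    ∃[ c' ] (c' ≢ j × nth L c' ≡ just x × (∀ y → set (delete L j) c y ≡ delete (set L c' y) j))
  nth-delete⁻ []      j             c             ()
  nth-delete⁻ (w ∷ L) zero          zero          ()
  nth-delete⁻ (w ∷ L) zero          (suc c)       p = suc c , (λ ()) , p , λ y → sym (delete-zero _)
  nth-delete⁻ (w ∷ L) (suc zero)    zero          p = ⊥-elim (nth-zero L p)
  nth-delete⁻ (w ∷ L) (suc zero)    (suc c)       p = suc (suc c) , (λ ()) , p , λ y → refl
  nth-delete⁻ (w ∷ L) (suc (suc j)) zero          ()
  nth-delete⁻ (w ∷ L) (suc (suc j)) (suc zero)    p = suc zero , (λ ()) , p , λ y → refl
  nth-delete⁻ (w ∷ L) (suc (suc j)) (suc (suc c)) p with nth-delete⁻ L (suc j) (suc c) p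
  ... | zero   , _     , q , _          = ⊥-elim (nth-zero L q)
  ... | suc c' , c'≢j , q , set-delete =
    suc (suc c') , c'≢j ∘ suc-injective , q , λ y → cong (w ∷_) (set-delete y)

  nth-snoc⁻ : ∀ (L : List A) d {x y} → nth (L ++ [ y ]) d ≡ just x →
    (nth L d ≡ just x × (∀ z → set (L ++ [ y ]) d z ≡ set L d z ++ [ y ]))
    ⊎ (x ≡ y × (∀ z → set (L ++ [ y ]) d z ≡ L ++ [ z ]))
  nth-snoc⁻ []      zero          ()
  nth-snoc⁻ []      (suc zero)    refl = inj₂ (refl , λ z → refl)
  nth-snoc⁻ []      (suc (suc d)) ()
  nth-snoc⁻ (w ∷ L) zero          ()
  nth-snoc⁻ (w ∷ L) (suc zero)    p = inj₁ (p , λ z → refl)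
  nth-snoc⁻ (w ∷ L) (suc (suc d)) p with nth-snoc⁻ L (suc d) p
  ... | inj₁ (q , e) = inj₁ (q , λ z → cong (w ∷_) (e z))
  ... | inj₂ (q , e) = inj₂ (q , λ z → cong (w ∷_) (e z))

LocalStep-∷ : ∀ {μ Γ Γ'} w → μ ≢ π⁺ → LocalStep μ Γ Γ' → LocalStep μ (w ∷ Γ) (w ∷ Γ')
LocalStep-∷ w μ≢π⁺ (σ-step {Γ} {zero}        i≢j p q) = ⊥-elim (nth-zero Γ p)
LocalStep-∷ w μ≢π⁺ (σ-step {Γ} {suc i} {zero} i≢j p q) = ⊥-elim (nth-zero Γ q)
LocalStep-∷ w μ≢π⁺ (σ-step {Γ} {suc i} {suc j} i≢j p q) =
  σ-step {i = suc (suc i)} {j = suc (suc j)} (i≢j ∘ suc-injective) p q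
LocalStep-∷ w μ≢π⁺ (π⁺-step p) = ⊥-elim (μ≢π⁺ refl)
LocalStep-∷ w μ≢π⁺ (λ-step {Γ} {zero}  p β<α) = ⊥-elim (nth-zero Γ p)
LocalStep-∷ w μ≢π⁺ (λ-step {Γ} {suc i} p β<α) = λ-step {i = suc (suc i)} p β<α
LocalStep-∷ w μ≢π⁺ (J-step {Γ} {zero}         i≢j p q β<α) = ⊥-elim (nth-zero Γ p)
LocalStep-∷ w μ≢π⁺ (J-step {Γ} {suc i} {zero} i≢j p q β<α) = ⊥-elim (nth-zero Γ q)
LocalStep-∷ w μ≢π⁺ (J-step {Γ} {suc i} {suc j} i≢j p q β<α) =
  J-step {i = suc (suc i)} {j = suc (suc j)} (i≢j ∘ suc-injective) p q β<α

σ*-rotate : ∀ (L : List (ℕ × Tree)) x → Star (LocalStep σ) (L ++ [ x ]) (x ∷ L)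
σ*-rotate []      x = ε
σ*-rotate (y ∷ L) x =
  gmap (y ∷_) (LocalStep-∷ y (λ ())) (σ*-rotate L x) ◅◅ return (σ-step {i = 1} {j = 2} (λ ()) refl refl)

-- Step with its position unfolded one child at a time, so that induction on
-- positions becomes structural induction on the step.
data Deep (μ : Rule) : Tree → Tree → Set where
  root  : ∀ {Δ Γ Γ'} → LocalStep μ Γ Γ' → Deep μ ⟨ Δ ﹔ Γ ⟩ ⟨ Δ ﹔ Γ' ⟩
  child : ∀ {Δ Γ i α A A'} → nth Γ i ≡ just (α , A) → Deep μ A A' →
          Deep μ ⟨ Δ ﹔ Γ ⟩ ⟨ Δ ﹔ set Γ i (α , A') ⟩

Deep-≡ : ∀ {μ T Δ Γ Γ'} → Γ ≡ Γ' → Deep μ T ⟨ Δ ﹔ Γ ⟩ → Deep μ T ⟨ Δ ﹔ Γ' ⟩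
Deep-≡ refl d = d

subtreeChild-nth : ∀ Γ {i} r {α A} → nth Γ i ≡ just (α , A) → subtreeChild Γ i r ≡ subtree A r
subtreeChild-nth []                    r ()
subtreeChild-nth (_ ∷ Γ) {zero}        r ()
subtreeChild-nth (_ ∷ Γ) {suc zero}    r refl = refl
subtreeChild-nth (_ ∷ Γ) {suc (suc i)} r p    = subtreeChild-nth Γ r p

replaceChild-nth : ∀ Γ {i} r {α A} X → nth Γ i ≡ just (α , A) →
                   replaceChild Γ i r X ≡ set Γ i (α , replace A r X)
replaceChild-nth []                    r X ()
replaceChild-nth (_ ∷ Γ) {zero}        r X ()
replaceChild-nth (_ ∷ Γ) {suc zero}    r X refl = refl
replaceChild-nth (y ∷ Γ) {suc (suc i)} r X p    = cong (y ∷_) (replaceChild-nth Γ r X p)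

subtreeChild⁻ : ∀ Γ i r {N} → subtreeChild Γ i r ≡ just N →
                ∃[ α ] ∃[ A ] (nth Γ i ≡ just (α , A) × subtree A r ≡ just N)
subtreeChild⁻ []            i             r ()
subtreeChild⁻ ((β , B) ∷ Γ) zero          r ()
subtreeChild⁻ ((β , B) ∷ Γ) (suc zero)    r p = β , B , refl , p
subtreeChild⁻ ((β , B) ∷ Γ) (suc (suc i)) r p = subtreeChild⁻ Γ (suc i) r p

Deep-at : ∀ {μ} k {T Δ Γ Γ'} → subtree T k ≡ just ⟨ Δ ﹔ Γ ⟩ → LocalStep μ Γ Γ' →
          Deep μ T (replace T k ⟨ Δ ﹔ Γ' ⟩)
Deep-at []      refl l = root l
Deep-at (i ∷ r) {⟨ Δ ﹔ Γ ⟩} p l with subtreeChild⁻ Γ i r p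
... | α , A , q , s = Deep-≡ (sym (replaceChild-nth Γ r _ q)) (child q (Deep-at r s l))

Step⇒Deep : ∀ {μ T T'} → Step μ T T' → Deep μ T T'
Step⇒Deep (step k p l) = Deep-at k p l

Deep⇒Step : ∀ {μ T T'} → Deep μ T T' → Step μ T T'
Deep⇒Step (root l) = step [] refl l
Deep⇒Step (child {Δ = Δ} {Γ} q d) with Deep⇒Step d
... | step r p l = subst (Step _ ⟨ Δ ﹔ Γ ⟩ ∘ ⟨ Δ ﹔_⟩) (replaceChild-nth Γ r _ q)
                         (step (_ ∷ r) (trans (subtreeChild-nth Γ r q) p) l)

Deep*⇒Steps : ∀ {μ T T'} → Star (Deep μ) T T' → Steps μ T T'
Deep*⇒Steps = gmap _ Deep⇒Step

Deep*-child : ∀ {μ Δ Γ i α A₀ A A'} → nth Γ i ≡ just (α , A₀) → Star (Deep μ) A A' →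
              Star (Deep μ) ⟨ Δ ﹔ set Γ i (α , A) ⟩ ⟨ Δ ﹔ set Γ i (α , A') ⟩
Deep*-child {Γ = Γ} {i} {α} p =
  gmap _ (λ {A} {A'} d → Deep-≡ (set-set-≡ Γ i (α , A) (α , A')) (child (nth-set-≡ Γ i p) d))

Reordered : Rule → Tree → Tree → Set
Reordered θ T S = ∃[ U ] ∃[ V ] (Star (Deep π⁺) T U × Star (Deep θ) U V × Star (Deep σ) V S)

Reordered-≡ : ∀ {θ T Δ Γ Γ'} → Γ ≡ Γ' → Reordered θ T ⟨ Δ ﹔ Γ ⟩ → Reordered θ T ⟨ Δ ﹔ Γ' ⟩
Reordered-≡ refl r = r

π⁺*θ* : ∀ {θ T U V} → Star (Deep π⁺) T U → Star (Deep θ) U V → Reordered θ T V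
π⁺*θ* π⁺s θs = _ , _ , π⁺s , θs , ε

commute : ∀ {θ T U Δ Γ Γ'} → Deep π⁺ T U → Deep θ U ⟨ Δ ﹔ Γ ⟩ → Γ ≡ Γ' →
          Reordered θ T ⟨ Δ ﹔ Γ' ⟩
commute d e refl = π⁺*θ* (return d) (return e)

Reordered-child : ∀ {θ Δ Γ i α A A'} → nth Γ i ≡ just (α , A) → Reordered θ A A' →
                  Reordered θ ⟨ Δ ﹔ Γ ⟩ ⟨ Δ ﹔ set Γ i (α , A') ⟩
Reordered-child {Δ = Δ} {Γ} {i} p (_ , _ , π⁺s , θs , σs) =
  _ , _ , subst (λ L → Star (Deep π⁺) ⟨ Δ ﹔ L ⟩ _) (set-nth-id Γ i p) (Deep*-child p π⁺s) ,
  Deep*-child p θs , Deep*-child p σs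

λ-then-π⁺ : ∀ {Δ Γ i α β A S} → nth Γ i ≡ just (α , A) → β < α →
            Deep π⁺ ⟨ Δ ﹔ set Γ i (β , A) ⟩ S → Reordered λ' ⟨ Δ ﹔ Γ ⟩ S
λ-then-π⁺ {Γ = Γ} {i} {β = β} {A} p β<α (root (π⁺-step {i = c} q)) with nth-set⁻ Γ i c (β , A) q
... | inj₁ (refl , refl) =
  π⁺*θ* (return (root (π⁺-step p)))
        (root (λ-step {i = 1} refl β<α) ◅ root (LocalStep-∷ _ (λ ()) (λ-step p β<α)) ◅ ε)
... | inj₂ (_ , q') = commute (root (π⁺-step q')) (root (LocalStep-∷ _ (λ ()) (λ-step p β<α))) refl
λ-then-π⁺ {Γ = Γ} {i} {β = β} {A} p β<α (child {i = c} q d) with nth-set⁻ Γ i c (β , A) q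
... | inj₁ (refl , refl) =
  commute (child p d) (root (λ-step (nth-set-≡ Γ i p) β<α))
          (trans (set-set-≡ Γ i _ _) (sym (set-set-≡ Γ i _ _)))
... | inj₂ (c≢i , q') =
  commute (child q' d) (root (λ-step (trans (nth-set-≢ Γ _ c≢i) p) β<α)) (set-set-≢ Γ c≢i)

data SnocView (Δ : List PropVar) (L : List (ℕ × Tree)) (β : ℕ) (B : Tree) : Tree → Set where
  front    : ∀ {L'} → Deep π⁺ ⟨ Δ ﹔ L ⟩ ⟨ Δ ﹔ L' ⟩ → SnocView Δ L β B ⟨ Δ ﹔ L' ++ [ (β , B) ] ⟩
  dup-last : SnocView Δ L β B ⟨ Δ ﹔ (β , B) ∷ L ++ [ (β , B) ] ⟩
  in-last  : ∀ {B'} → Deep π⁺ B B' → SnocView Δ L β B ⟨ Δ ﹔ L ++ [ (β , B') ] ⟩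

snocView : ∀ {Δ L β B X} → Deep π⁺ ⟨ Δ ﹔ L ++ [ (β , B) ] ⟩ X → SnocView Δ L β B X
snocView {L = L} (root (π⁺-step {i = e} s)) with nth-snoc⁻ L e s
... | inj₁ (s' , _)   = front (root (π⁺-step s'))
... | inj₂ (refl , _) = dup-last
snocView {Δ} {L} {β} {B} (child {i = e} s d) with nth-snoc⁻ L e s
... | inj₁ (s' , set-snoc) =
  subst (SnocView Δ L β B ∘ ⟨ Δ ﹔_⟩) (sym (set-snoc _)) (front (child s' d))
... | inj₂ (refl , set-snoc) =
  subst (SnocView Δ L β B ∘ ⟨ Δ ﹔_⟩) (sym (set-snoc _)) (in-last d)

module _ {Δ : List PropVar} {Γ i j α β Δ̃ Γ̃ B} (i≢j : i ≢ j) (p : nth Γ i ≡ just (α , ⟨ Δ̃ ﹔ Γ̃ ⟩))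
         (q : nth Γ j ≡ just (β , B)) (β<α : β < α) where

  private
    A⁺ : Tree
    A⁺ = ⟨ Δ̃ ﹔ Γ̃ ++ [ (β , B) ] ⟩

    Γ' : List (ℕ × Tree)
    Γ' = delete (set Γ i (α , A⁺)) j

    j-unchanged : ∀ y → nth (set Γ i y) j ≡ just (β , B)
    j-unchanged y = trans (nth-set-≢ Γ y i≢j) q

  -- c is the position that entry i of Γ occupies in Γ'.
  J-then-π⁺-receiver : ∀ {c E'} → nth Γ' c ≡ just (α , A⁺) →
    (∀ y → set Γ' c y ≡ delete (set Γ i y) j) →
    SnocView Δ̃ Γ̃ β B E' → Reordered J ⟨ Δ ﹔ Γ ⟩ ⟨ Δ ﹔ set Γ' c (α , E') ⟩
  J-then-π⁺-receiver r set-delete (front d) =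
    commute (child p d) (root (J-step i≢j (nth-set-≡ Γ i p) (j-unchanged _) β<α))
            (trans (cong (λ L → delete L j) (set-set-≡ Γ i _ _)) (sym (set-delete _)))
  J-then-π⁺-receiver r set-delete (in-last d) =
    commute (child q d) (root (J-step i≢j (trans (nth-set-≢ Γ _ (i≢j ∘ sym)) p) (nth-set-≡ Γ j q) β<α))
            (trans (cong (λ L → delete L j) (set-set-≢ Γ (i≢j ∘ sym)))
            (trans (delete-set-≡ (set Γ i _) j _) (sym (set-delete _))))
  J-then-π⁺-receiver {c} r set-delete dup-last =
    _ , _ , return (root (π⁺-step q)) , J-twice , rotate
    where
    A⁺⁺ : Tree
    A⁺⁺ = ⟨ Δ̃ ﹔ (Γ̃ ++ [ (β , B) ]) ++ [ (β , B) ] ⟩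

    J-twice : Star (Deep J) ⟨ Δ ﹔ (β , B) ∷ Γ ⟩ ⟨ Δ ﹔ delete (set (set Γ i (α , A⁺)) i (α , A⁺⁺)) j ⟩
    J-twice =
      Deep-≡ (cong (λ L → delete L 1) (set-∷ Γ p))
        (root (J-step {i = suc i} {j = 1} (nth-just⇒≢0 Γ p ∘ suc-injective) (nth-∷ Γ p) refl β<α)) ◅
      root (J-step i≢j (nth-set-≡ Γ i p) (j-unchanged _) β<α) ◅ ε

    rotate : Star (Deep σ) ⟨ Δ ﹔ delete (set (set Γ i (α , A⁺)) i (α , A⁺⁺)) j ⟩
                           ⟨ Δ ﹔ set Γ' c (α , ⟨ Δ̃ ﹔ (β , B) ∷ Γ̃ ++ [ (β , B) ] ⟩) ⟩
    rotate =
      subst (λ L → Star (Deep σ) ⟨ Δ ﹔ L ⟩ ⟨ Δ ﹔ set Γ' c (α , ⟨ Δ̃ ﹔ (β , B) ∷ Γ̃ ++ [ (β , B) ] ⟩) ⟩)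
            (trans (set-delete (α , A⁺⁺)) (cong (λ L → delete L j) (sym (set-set-≡ Γ i (α , A⁺) (α , A⁺⁺)))))
            (Deep*-child r (gmap ⟨ Δ̃ ﹔_⟩ root (σ*-rotate (Γ̃ ++ [ (β , B) ]) (β , B))))

  J-then-π⁺ : ∀ {S} → Deep π⁺ ⟨ Δ ﹔ Γ' ⟩ S → Reordered J ⟨ Δ ﹔ Γ ⟩ S
  J-then-π⁺ (root (π⁺-step {i = c} r)) with nth-delete⁻ (set Γ i (α , A⁺)) j c r
  ... | c' , _ , r' , _ with nth-set⁻ Γ i c' _ r'
  ... | inj₁ (refl , refl) =
    π⁺*θ* (root (π⁺-step q) ◅ root (π⁺-step {i = suc i} (nth-∷ Γ p)) ◅ ε)
          (root (J-step {i = 1} {j = 2} (λ ()) refl refl β<α) ◅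
           root (LocalStep-∷ _ (λ ()) (J-step i≢j p q β<α)) ◅ ε)
  ... | inj₂ (_ , r'') =
    commute (root (π⁺-step r'')) (root (LocalStep-∷ _ (λ ()) (J-step i≢j p q β<α))) refl
  J-then-π⁺ (child {i = c} r d) with nth-delete⁻ (set Γ i (α , A⁺)) j c r
  ... | c' , c'≢j , r' , set-delete with nth-set⁻ Γ i c' _ r'
  ... | inj₁ (refl , refl) =
    J-then-π⁺-receiver r (λ y → trans (set-delete y) (cong (λ L → delete L j) (set-set-≡ Γ i _ _)))
                       (snocView d)
  ... | inj₂ (c'≢i , r'') =
    commute (child r'' d)
            (root (J-step i≢j (trans (nth-set-≢ Γ _ c'≢i) p) (trans (nth-set-≢ Γ _ c'≢j) q) β<α))
            (trans (cong (λ L → delete L j) (set-set-≢ Γ c'≢i)) (sym (set-delete _)))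

mutual
  reorder : ∀ {θ T U S} → θ ≡ λ' ⊎ θ ≡ J → Deep θ T U → Deep π⁺ U S → Reordered θ T S
  reorder _ (root (λ-step p β<α))       e = λ-then-π⁺ p β<α e
  reorder _ (root (J-step i≢j p q β<α)) e = J-then-π⁺ i≢j p q β<α e
  reorder (inj₁ ()) (root (σ-step _ _ _)) _
  reorder (inj₂ ()) (root (σ-step _ _ _)) _
  reorder (inj₁ ()) (root (π⁺-step _)) _
  reorder (inj₂ ()) (root (π⁺-step _)) _
  reorder θ-ok (child p d) e = child-then-π⁺ θ-ok p d e

  child-then-π⁺ : ∀ {θ Δ Γ i α A A' S} → θ ≡ λ' ⊎ θ ≡ J → nth Γ i ≡ just (α , A) → Deep θ A A' →
                  Deep π⁺ ⟨ Δ ﹔ set Γ i (α , A') ⟩ S → Reordered θ ⟨ Δ ﹔ Γ ⟩ S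
  child-then-π⁺ {Γ = Γ} {i} {α} {A' = A'} _ p d (root (π⁺-step {i = c} q))
    with nth-set⁻ Γ i c (α , A') q
  ... | inj₁ (refl , refl) =
    Reordered-≡ (set-∷ Γ p) (π⁺*θ* (return (root (π⁺-step p))) (child {i = 1} refl d ◅ child (nth-∷ Γ p) d ◅ ε))
  ... | inj₂ (_ , q') = commute (root (π⁺-step q')) (child (nth-∷ Γ p) d) (set-∷ Γ p)
  child-then-π⁺ {Γ = Γ} {i} {α} {A' = A'} θ-ok p d (child {i = c} q e)
    with nth-set⁻ Γ i c (α , A') q
  ... | inj₁ (refl , refl) = Reordered-≡ (sym (set-set-≡ Γ i _ _)) (Reordered-child p (reorder θ-ok d e))
  ... | inj₂ (c≢i , q') = commute (child q' e) (child (trans (nth-set-≢ Γ _ c≢i) p) d) (set-set-≢ Γ c≢i)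

mainTheorem7 : (θ : Rule) → θ ≡ λ' ⊎ θ ≡ J → (T S : Tree) →
    (∃[ U ] (Step θ T U × Step π⁺ U S)) →
    ∃[ U ] ∃[ V ] (Steps π⁺ T U × Steps θ U V × Steps σ V S)
mainTheorem7 θ θ-ok T S (U , s₁ , s₂) with reorder θ-ok (Step⇒Deep s₁) (Step⇒Deep s₂)
... | U' , V , π⁺s , θs , σs = U' , V , Deep*⇒Steps π⁺s , Deep*⇒Steps θs , Deep*⇒Steps σs
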